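{- Let $k\ge 1$ be an integer and let $$C_k(x,q)=\sum_{n\ge 0}\sum_{\pi\in[k]^n} x^n q^{\mathrm{kcon}(\pi)}.$$ Then $$C_k(x,q)=\frac{1}{1-x-\left(\dfrac{x+x^2(q-1)}{1-x^2(q-1)^2}\right)(k-1)}.$$
   Context: $[k]=\{1,2,\ldots,k\}$, and $[k]^n$ is the set of words $\pi=\pi_1\pi_2\cdots\pi_n$ of length $n$ over the alphabet $[k]$ (including the empty word for $n=0$). A k-connector of $\pi$ is an index $j$ with $1\le j\le n-1$ and $\pi_j+\pi_{j+1}=k$; $\mathrm{kcon}(\pi)$ denotes the number of k-connectors of $\pi$. The generating function is a formal power series in $x$ with coefficients polynomials in $q$. -}

module Defs where

open import Data.Nat as ℕ using (ℕ; zero; suc; _≟_)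
open import Data.Integer as ℤ using (ℤ; +_; _+_; _*_; _-_; -_; _^_)
open import Data.Fin using (Fin; toℕ)
open import Data.Vec as Vec using (Vec; []; _∷_)
open import Data.List as List using (List; []; _∷_; map; concatMap; zipWith; upTo; length; foldr)
open import Data.List.Base using (allFin)
open import Relation.Nullary using (yes; no)

sumℤ : List ℤ → ℤ
sumℤ = foldr _+_ (+ 0)

-- Words over [k]: a letter i ∈ [k] is represented by  t : Fin k  with
-- value  toℕ t + 1.

allWords : (k n : ℕ) → List (Vec (Fin k) n)
allWords k zero    = Vec.[] ∷ []
allWords k (suc n) = concatMap (λ a → map (a Vec.∷_) (allWords k n)) (allFin k)

conn : ∀ {k} → Fin k → Fin k → ℕ
conn {k} a b with (suc (toℕ a) ℕ.+ suc (toℕ b)) ≟ k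
... | yes _ = 1
... | no  _ = 0

kcon : ∀ {k n} → Vec (Fin k) n → ℕ
kcon []                = 0
kcon (a ∷ [])          = 0
kcon (a ∷ b ∷ w)       = conn a b ℕ.+ kcon (b ∷ w)

-- Formal power series in x with integer coefficients (coefficient
-- sequences).  The variable q is evaluated at an arbitrary integer.

Series : Set
Series = ℕ → ℤ

Ck : (k : ℕ) → (q : ℤ) → Series
Ck k q n = sumℤ (map (λ π → q ^ kcon π) (allWords k n))

oneS : Series
oneS zero    = + 1
oneS (suc _) = + 0

X : Series
X 1 = + 1
X _ = + 0

_⊕_ : Series → Series → Series
(f ⊕ g) n = f n + g n

_⊖_ : Series → Series → Series
(f ⊖ g) n = f n - g n

scale : ℤ → Series → Series
scale c f n = c * f n

_⊛_ : Series → Series → Series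
(f ⊛ g) n = sumℤ (map (λ i → f i * g (n ℕ.∸ i)) (upTo (suc n)))

infixl 6 _⊕_ _⊖_
infixl 7 _⊛_

-- Multiplicative inverse of a series f with constant term 1:
-- b_0 = 1,  b_{m+1} = - Σ_{i=1}^{m+1} f_i b_{m+1-i}.
-- invVec f n = [b_n, b_{n-1}, …, b_0].
invVec : Series → (n : ℕ) → Vec ℤ (suc n)
invVec f zero    = (+ 1) ∷ []
invVec f (suc n) =
  let l = invVec f n
  in (- sumℤ (zipWith _*_ (map (λ j → f (suc j)) (upTo (suc n))) (Vec.toList l))) ∷ l

-- 1/f (meaningful for f with f 0 = 1, the only case used below)
inv1 : Series → Series
inv1 f n = Vec.head (invVec f n)

RHS : (k : ℕ) → (q : ℤ) → Series
RHS k q =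
  inv1 (oneS ⊖ X ⊖
        scale (+ k - + 1)
          ((X ⊕ scale (q - + 1) (X ⊛ X))
             ⊛ inv1 (oneS ⊖ scale ((q - + 1) * (q - + 1)) (X ⊛ X))))

-- Both sides are the sequence with c₀ = 1, c₁ = k and c_{n+2} = (k + p) c_{n+1} - p c_n,
-- where p = q - 1.  For words, write q^conn = 1 + p·conn and sum over the first two
-- letters: this gives k c_{n+1} plus p times the sum, over words of length n + 1, of
-- the number of partners of their first letter.  Every letter except k has exactly one
-- partner and k has none; and k starts no connector, so the words starting with k
-- weigh c_n.  Hence that sum is c_{n+1} - c_n.
-- For the series, (x + p x²)/(1 - p² x²) = x/(1 - p x), so the right-hand side is
-- (1 - p x)/(1 - (k + p) x + p x²).
module Submission where

open import Defs
open import Data.Nat using (ℕ; _≤_)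
open import Data.Integer using (ℤ)
open import Relation.Binary.PropositionalEquality using (_≡_)

open import Data.Nat as ℕ using (zero; suc; z≤n; s≤s; z<s; _<_; _∸_)
import Data.Nat.Properties as ℕₚ
open import Data.Integer using (+_; _+_; _*_; _-_; -_; _^_)
import Data.Integer.Properties as ℤₚ
open import Data.Integer.Tactic.RingSolver using (solve-∀)
open import Data.Fin as Fin using (Fin; toℕ; fromℕ; inject₁)
open import Data.Fin.Properties using (toℕ<n; toℕ-fromℕ; toℕ-inject₁)
open import Data.Vec as Vec using (Vec; _∷_)
open import Data.List using (List; []; _∷_; _++_; map; concatMap; zipWith; applyUpTo; upTo; tabulate)
open import Data.List.Properties using (map-++; map-∘; map-cong; map-applyUpTo)
open import Function using (_∘_)
open import Relation.Binary.PropositionalEquality using (_≢_; refl; sym; trans; cong; cong₂; subst; module ≡-Reasoning)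
open import Relation.Nullary using (yes; no)
open import Data.Empty using (⊥-elim)
open import Algebra.Properties.Semiring.Sum ℤₚ.+-*-semiring
  using (sum; sum-syntax; sum-cong-≗; ∑-distrib-+; ∑-comm; sum-replicate-zero; sum-init-last; *-distribˡ-sum; *-distribʳ-sum)

open ≡-Reasoning

∑-const : ∀ n (x : ℤ) → ∑[ _ < n ] x ≡ + n * x
∑-const zero    x = refl
∑-const (suc n) x = trans (cong (_+_ x) (∑-const n x)) (sym (ℤₚ.suc-* (+ n) x))

second-order-recurrence-unique : ∀ (α β : ℤ) (u v : ℕ → ℤ) →
  (∀ n → u (suc (suc n)) ≡ α * u (suc n) - β * u n) →
  (∀ n → v (suc (suc n)) ≡ α * v (suc n) - β * v n) →
  u 0 ≡ v 0 → u 1 ≡ v 1 → ∀ n → u n ≡ v n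
second-order-recurrence-unique α β u v recᵤ recᵥ u₀≡v₀ u₁≡v₁ zero          = u₀≡v₀
second-order-recurrence-unique α β u v recᵤ recᵥ u₀≡v₀ u₁≡v₁ (suc zero)    = u₁≡v₁
second-order-recurrence-unique α β u v recᵤ recᵥ u₀≡v₀ u₁≡v₁ (suc (suc n)) =
  trans (recᵤ n) (trans (cong₂ (λ x y → α * x - β * y) (unique (suc n)) (unique n)) (sym (recᵥ n)))
  where
  unique : ∀ n → u n ≡ v n
  unique = second-order-recurrence-unique α β u v recᵤ recᵥ u₀≡v₀ u₁≡v₁

sumℤ-++ : ∀ xs ys → sumℤ (xs ++ ys) ≡ sumℤ xs + sumℤ ys
sumℤ-++ []       ys = sym (ℤₚ.+-identityˡ _)
sumℤ-++ (x ∷ xs) ys = trans (cong (_+_ x) (sumℤ-++ xs ys)) (sym (ℤₚ.+-assoc x _ _))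

sumℤ-map-*ˡ : ∀ {A : Set} c (h : A → ℤ) xs → sumℤ (map (λ x → c * h x) xs) ≡ c * sumℤ (map h xs)
sumℤ-map-*ˡ c h []       = sym (ℤₚ.*-zeroʳ c)
sumℤ-map-*ˡ c h (x ∷ xs) =
  trans (cong (_+_ (c * h x)) (sumℤ-map-*ˡ c h xs)) (sym (ℤₚ.*-distribˡ-+ c (h x) _))

sumℤ-concatMap-tabulate : ∀ {A B : Set} {n} (h : B → ℤ) (G : A → List B) (g : Fin n → A) →
  sumℤ (map h (concatMap G (tabulate g))) ≡ ∑[ i < n ] sumℤ (map h (G (g i)))
sumℤ-concatMap-tabulate {n = zero}  h G g = refl
sumℤ-concatMap-tabulate {n = suc n} h G g = begin
  sumℤ (map h (G (g Fin.zero) ++ concatMap G (tabulate (g ∘ Fin.suc))))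
    ≡⟨ cong sumℤ (map-++ h (G (g Fin.zero)) _) ⟩
  sumℤ (map h (G (g Fin.zero)) ++ map h (concatMap G (tabulate (g ∘ Fin.suc))))
    ≡⟨ sumℤ-++ (map h (G (g Fin.zero))) _ ⟩
  sumℤ (map h (G (g Fin.zero))) + sumℤ (map h (concatMap G (tabulate (g ∘ Fin.suc))))
    ≡⟨ cong (_+_ (sumℤ (map h (G (g Fin.zero))))) (sumℤ-concatMap-tabulate h G (g ∘ Fin.suc)) ⟩
  ∑[ i < suc n ] sumℤ (map h (G (g i)))
    ∎

sumℤ-map-applyUpTo : ∀ (f : ℕ → ℤ) (g : ℕ → ℕ) n → sumℤ (map f (applyUpTo g n)) ≡ ∑[ i < n ] f (g (toℕ i))
sumℤ-map-applyUpTo f g zero    = refl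
sumℤ-map-applyUpTo f g (suc n) = cong (_+_ (f (g 0))) (sumℤ-map-applyUpTo f (g ∘ suc) n)

sumℤ-zipWith-applyUpTo : ∀ (g h : ℕ → ℤ) n →
  sumℤ (zipWith _*_ (applyUpTo g n) (applyUpTo h n)) ≡ ∑[ i < n ] (g (toℕ i) * h (toℕ i))
sumℤ-zipWith-applyUpTo g h zero    = refl
sumℤ-zipWith-applyUpTo g h (suc n) = cong (_+_ (g 0 * h 0)) (sumℤ-zipWith-applyUpTo (g ∘ suc) (h ∘ suc) n)

-- Counting words by k-connectors

sumℤ-allWords-suc : ∀ k n (h : Vec (Fin k) (suc n) → ℤ) →
  sumℤ (map h (allWords k (suc n))) ≡ ∑[ a < k ] sumℤ (map (h ∘ (a ∷_)) (allWords k n))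
sumℤ-allWords-suc k n h = trans (sumℤ-concatMap-tabulate {n = k} h (λ a → map (a ∷_) (allWords k n)) (λ a → a))
  (sum-cong-≗ {k} (λ a → cong sumℤ (sym (map-∘ (allWords k n)))))

δ : ℕ → ℕ → ℕ
δ zero    zero    = 1
δ zero    (suc _) = 0
δ (suc _) zero    = 0
δ (suc m) (suc n) = δ m n

δ-refl : ∀ n → δ n n ≡ 1
δ-refl zero    = refl
δ-refl (suc n) = δ-refl n

δ-≢ : ∀ m n → m ≢ n → δ m n ≡ 0
δ-≢ zero    zero    m≢n = ⊥-elim (m≢n refl)
δ-≢ zero    (suc n) _   = refl
δ-≢ (suc m) zero    _   = refl
δ-≢ (suc m) (suc n) m≢n = δ-≢ m n (m≢n ∘ cong suc)

δ-> : ∀ {m n} → n < m → δ m n ≡ 0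
δ-> {suc m} {zero}  _         = refl
δ-> {suc m} {suc n} (s≤s n<m) = δ-> n<m

∑-δ-offset : ∀ m c t → c ≤ t → t < c ℕ.+ m → ∑[ i < m ] (+ δ (c ℕ.+ toℕ i) t) ≡ + 1
∑-δ-offset m       (suc c) (suc t) (s≤s c≤t) (s≤s t<c+m) = ∑-δ-offset m c t c≤t t<c+m
∑-δ-offset (suc m) zero    zero    _ _         = cong (_+_ (+ 1)) (sum-replicate-zero m)
∑-δ-offset (suc m) zero    (suc t) _ (s≤s t<m) = trans (ℤₚ.+-identityˡ _) (∑-δ-offset m zero t z≤n t<m)

conn≡δ : ∀ {k} (a b : Fin k) → conn a b ≡ δ (suc (toℕ a) ℕ.+ suc (toℕ b)) k
conn≡δ {k} a b with suc (toℕ a) ℕ.+ suc (toℕ b) ℕ.≟ k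
... | yes eq  = sym (trans (cong (λ m → δ m k) eq) (δ-refl k))
... | no  neq = sym (δ-≢ _ k neq)

^-conn : ∀ {k} q (a b : Fin k) → q ^ conn a b ≡ + 1 + (q - + 1) * + conn a b
^-conn {k} q a b with suc (toℕ a) ℕ.+ suc (toℕ b) ℕ.≟ k
... | yes _ = q¹ q
  where
  q¹ : ∀ q → q * + 1 ≡ + 1 + (q - + 1) * + 1
  q¹ = solve-∀
... | no  _ = q⁰ q
  where
  q⁰ : ∀ q → + 1 ≡ + 1 + (q - + 1) * + 0
  q⁰ = solve-∀

conn-overflow : ∀ {k} (a b : Fin k) → k < suc (toℕ a) ℕ.+ suc (toℕ b) → conn a b ≡ 0
conn-overflow a b k<a+b = trans (conn≡δ a b) (δ-> k<a+b)

conn-fromℕˡ : ∀ {k'} (b : Fin (suc k')) → conn (fromℕ k') b ≡ 0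
conn-fromℕˡ {k'} b = conn-overflow (fromℕ k') b
  (subst (λ m → suc k' < suc m ℕ.+ suc (toℕ b)) (sym (toℕ-fromℕ k')) (ℕₚ.m<m+n (suc k') z<s))

conn-fromℕʳ : ∀ {k'} (a : Fin (suc k')) → conn a (fromℕ k') ≡ 0
conn-fromℕʳ {k'} a = conn-overflow a (fromℕ k')
  (subst (λ m → suc k' < suc (toℕ a) ℕ.+ suc m) (sym (toℕ-fromℕ k')) (ℕₚ.m<n+m (suc k') z<s))

-- A letter v < k has exactly one partner, the letter k - v.
∑-conn-inject₁ : ∀ {k'} (b : Fin k') → ∑[ a < suc k' ] (+ conn a (inject₁ b)) ≡ + 1
∑-conn-inject₁ {k'} b = begin
  ∑[ a < suc k' ] (+ conn a (inject₁ b))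
    ≡⟨ sum-cong-≗ {suc k'} (λ a → cong +_ (trans (conn≡δ a (inject₁ b)) (cong (λ m → δ m (suc k')) (partner a)))) ⟩
  ∑[ a < suc k' ] (+ δ (suc (suc (toℕ b)) ℕ.+ toℕ a) (suc k'))
    ≡⟨ ∑-δ-offset (suc k') (suc (suc (toℕ b))) (suc k') (s≤s (toℕ<n b)) (s≤s (ℕₚ.m≤n+m (suc k') (suc (toℕ b)))) ⟩
  + 1
    ∎
  where
  partner : ∀ a → suc (toℕ a) ℕ.+ suc (toℕ (inject₁ b)) ≡ suc (suc (toℕ b)) ℕ.+ toℕ a
  partner a = cong suc (trans (ℕₚ.+-comm (toℕ a) _) (cong (λ m → suc m ℕ.+ toℕ a) (toℕ-inject₁ b)))

∑-conn-fromℕ : ∀ k' → ∑[ a < suc k' ] (+ conn a (fromℕ k')) ≡ + 0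
∑-conn-fromℕ k' = trans (sum-cong-≗ {suc k'} (λ a → cong +_ (conn-fromℕʳ a))) (sum-replicate-zero (suc k'))

∑-conn-weighted : ∀ k' (f : Fin (suc k') → ℤ) →
  ∑[ b < suc k' ] (∑[ a < suc k' ] (+ conn a b) * f b) ≡ sum f - f (fromℕ k')
∑-conn-weighted k' f = begin
  ∑[ b < suc k' ] (∑[ a < suc k' ] (+ conn a b) * f b)
    ≡⟨ sum-init-last (λ b → ∑[ a < suc k' ] (+ conn a b) * f b) ⟩
  ∑[ b < k' ] (∑[ a < suc k' ] (+ conn a (inject₁ b)) * f (inject₁ b))
    + ∑[ a < suc k' ] (+ conn a (fromℕ k')) * f (fromℕ k')
    ≡⟨ cong₂ _+_ (sum-cong-≗ {k'} (λ b → trans (cong (_* f (inject₁ b)) (∑-conn-inject₁ b)) (ℤₚ.*-identityˡ _)))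
                 (cong (_* f (fromℕ k')) (∑-conn-fromℕ k')) ⟩
  sum (f ∘ inject₁) + + 0 * f (fromℕ k')
    ≡⟨ cancel (sum (f ∘ inject₁)) (f (fromℕ k')) ⟩
  (sum (f ∘ inject₁) + f (fromℕ k')) - f (fromℕ k')
    ≡⟨ cong (_- f (fromℕ k')) (sym (sum-init-last f)) ⟩
  sum f - f (fromℕ k')
    ∎
  where
  cancel : ∀ s x → s + + 0 * x ≡ (s + x) - x
  cancel = solve-∀

∑∑-affine : ∀ {m} c (M : Fin m → Fin m → ℤ) (f : Fin m → ℤ) →
  ∑[ a < m ] ∑[ b < m ] ((+ 1 + c * M a b) * f b) ≡ + m * sum f + c * ∑[ b < m ] (∑[ a < m ] M a b * f b)
∑∑-affine {m} c M f = begin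
  ∑[ a < m ] ∑[ b < m ] ((+ 1 + c * M a b) * f b)
    ≡⟨ sum-cong-≗ {m} (λ a → sum-cong-≗ {m} (λ b → expand c (M a b) (f b))) ⟩
  ∑[ a < m ] ∑[ b < m ] (f b + c * (M a b * f b))
    ≡⟨ sum-cong-≗ {m} (λ a → trans (∑-distrib-+ f _) (cong (_+_ (sum f)) (sym (*-distribˡ-sum c (λ b → M a b * f b))))) ⟩
  ∑[ a < m ] (sum f + c * ∑[ b < m ] (M a b * f b))
    ≡⟨ ∑-distrib-+ (λ _ → sum f) (λ a → c * ∑[ b < m ] (M a b * f b)) ⟩
  ∑[ _ < m ] sum f + ∑[ a < m ] (c * ∑[ b < m ] (M a b * f b))
    ≡⟨ cong₂ _+_ (∑-const m (sum f)) (sym (*-distribˡ-sum c (λ a → ∑[ b < m ] (M a b * f b)))) ⟩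
  + m * sum f + c * ∑[ a < m ] ∑[ b < m ] (M a b * f b)
    ≡⟨ cong (λ s → + m * sum f + c * s) (∑-comm (λ a b → M a b * f b)) ⟩
  + m * sum f + c * ∑[ b < m ] ∑[ a < m ] (M a b * f b)
    ≡⟨ cong (λ s → + m * sum f + c * s) (sum-cong-≗ {m} (λ b → sym (*-distribʳ-sum (f b) (λ a → M a b)))) ⟩
  + m * sum f + c * ∑[ b < m ] (∑[ a < m ] M a b * f b)
    ∎
  where
  expand : ∀ c x y → (+ 1 + c * x) * y ≡ y + c * (x * y)
  expand = solve-∀

module Words (k : ℕ) (q : ℤ) where

  Cfrom : Fin k → ℕ → ℤ
  Cfrom a n = sumℤ (map (λ w → q ^ kcon (a ∷ w)) (allWords k n))

  Ck-suc : ∀ n → Ck k q (suc n) ≡ sum (λ a → Cfrom a n)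
  Ck-suc n = sumℤ-allWords-suc k n (λ π → q ^ kcon π)

  Cfrom-suc : ∀ a n → Cfrom a (suc n) ≡ ∑[ b < k ] (q ^ conn a b * Cfrom b n)
  Cfrom-suc a n = trans (sumℤ-allWords-suc k n (λ w → q ^ kcon (a ∷ w))) (sum-cong-≗ {k} λ b → begin
    sumℤ (map (λ w → q ^ (conn a b ℕ.+ kcon (b ∷ w))) (allWords k n))
      ≡⟨ cong sumℤ (map-cong (λ w → ℤₚ.^-distribˡ-+-* q (conn a b) (kcon (b ∷ w))) (allWords k n)) ⟩
    sumℤ (map (λ w → q ^ conn a b * q ^ kcon (b ∷ w)) (allWords k n))
      ≡⟨ sumℤ-map-*ˡ (q ^ conn a b) (λ w → q ^ kcon (b ∷ w)) (allWords k n) ⟩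
    q ^ conn a b * Cfrom b n
      ∎)

  Ck-1 : Ck k q 1 ≡ + k
  Ck-1 = trans (Ck-suc 0) (trans (∑-const k (+ 1)) (ℤₚ.*-identityʳ (+ k)))

module _ (k' : ℕ) (q : ℤ) where
  open Words (suc k') q

  private
    k = suc k'
    p = q - + 1
    C = Ck k q

  Cfrom-fromℕ : ∀ n → Cfrom (fromℕ k') n ≡ C n
  Cfrom-fromℕ zero    = refl
  Cfrom-fromℕ (suc n) = begin
    Cfrom (fromℕ k') (suc n)
      ≡⟨ Cfrom-suc (fromℕ k') n ⟩
    ∑[ b < k ] (q ^ conn (fromℕ k') b * Cfrom b n)
      ≡⟨ sum-cong-≗ {k} (λ b → trans (cong (λ c → q ^ c * Cfrom b n) (conn-fromℕˡ b)) (ℤₚ.*-identityˡ _)) ⟩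
    sum (λ b → Cfrom b n)
      ≡⟨ Ck-suc n ⟨
    C (suc n)
      ∎

  Ck-rec : ∀ n → C (suc (suc n)) ≡ (+ k + p) * C (suc n) - p * C n
  Ck-rec n = begin
    C (suc (suc n))
      ≡⟨ Ck-suc (suc n) ⟩
    ∑[ a < k ] Cfrom a (suc n)
      ≡⟨ sum-cong-≗ {k} (λ a → Cfrom-suc a n) ⟩
    ∑[ a < k ] ∑[ b < k ] (q ^ conn a b * Cfrom b n)
      ≡⟨ sum-cong-≗ {k} (λ a → sum-cong-≗ {k} (λ b → cong (_* Cfrom b n) (^-conn q a b))) ⟩
    ∑[ a < k ] ∑[ b < k ] ((+ 1 + p * + conn a b) * Cfrom b n)
      ≡⟨ ∑∑-affine p (λ a b → + conn a b) (λ b → Cfrom b n) ⟩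
    + k * sum (λ b → Cfrom b n) + p * ∑[ b < k ] (∑[ a < k ] (+ conn a b) * Cfrom b n)
      ≡⟨ cong₂ (λ s t → + k * s + p * t) (sym (Ck-suc n)) (∑-conn-weighted k' (λ b → Cfrom b n)) ⟩
    + k * C (suc n) + p * (sum (λ b → Cfrom b n) - Cfrom (fromℕ k') n)
      ≡⟨ cong₂ (λ s t → + k * C (suc n) + p * (s - t)) (sym (Ck-suc n)) (Cfrom-fromℕ n) ⟩
    + k * C (suc n) + p * (C (suc n) - C n)
      ≡⟨ regroup (+ k) p (C (suc n)) (C n) ⟩
    (+ k + p) * C (suc n) - p * C n
      ∎
    where
    regroup : ∀ k p c₁ c₀ → k * c₁ + p * (c₁ - c₀) ≡ (k + p) * c₁ - p * c₀
    regroup = solve-∀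

-- Power series

⊛-as-∑ : ∀ f g n → (f ⊛ g) n ≡ ∑[ i < suc n ] (f (toℕ i) * g (n ∸ toℕ i))
⊛-as-∑ f g n = sumℤ-map-applyUpTo (λ i → f i * g (n ∸ i)) (λ i → i) (suc n)

⊕-⊛ : ∀ f g h n → ((f ⊕ g) ⊛ h) n ≡ (f ⊛ h) n + (g ⊛ h) n
⊕-⊛ f g h n = begin
  ((f ⊕ g) ⊛ h) n
    ≡⟨ ⊛-as-∑ (f ⊕ g) h n ⟩
  ∑[ i < suc n ] ((f (toℕ i) + g (toℕ i)) * h (n ∸ toℕ i))
    ≡⟨ sum-cong-≗ {suc n} (λ i → ℤₚ.*-distribʳ-+ (h (n ∸ toℕ i)) (f (toℕ i)) (g (toℕ i))) ⟩
  ∑[ i < suc n ] (f (toℕ i) * h (n ∸ toℕ i) + g (toℕ i) * h (n ∸ toℕ i))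
    ≡⟨ ∑-distrib-+ {suc n} (λ i → f (toℕ i) * h (n ∸ toℕ i)) (λ i → g (toℕ i) * h (n ∸ toℕ i)) ⟩
  ∑[ i < suc n ] (f (toℕ i) * h (n ∸ toℕ i)) + ∑[ i < suc n ] (g (toℕ i) * h (n ∸ toℕ i))
    ≡⟨ cong₂ _+_ (⊛-as-∑ f h n) (⊛-as-∑ g h n) ⟨
  (f ⊛ h) n + (g ⊛ h) n
    ∎

scale-⊛ : ∀ c f h n → (scale c f ⊛ h) n ≡ c * (f ⊛ h) n
scale-⊛ c f h n = begin
  (scale c f ⊛ h) n
    ≡⟨ ⊛-as-∑ (scale c f) h n ⟩
  ∑[ i < suc n ] (c * f (toℕ i) * h (n ∸ toℕ i))
    ≡⟨ sum-cong-≗ {suc n} (λ i → ℤₚ.*-assoc c (f (toℕ i)) (h (n ∸ toℕ i))) ⟩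
  ∑[ i < suc n ] (c * (f (toℕ i) * h (n ∸ toℕ i)))
    ≡⟨ *-distribˡ-sum {suc n} c (λ i → f (toℕ i) * h (n ∸ toℕ i)) ⟨
  c * ∑[ i < suc n ] (f (toℕ i) * h (n ∸ toℕ i))
    ≡⟨ cong (c *_) (⊛-as-∑ f h n) ⟨
  c * (f ⊛ h) n
    ∎

X-⊛-suc : ∀ g n → (X ⊛ g) (suc n) ≡ g n
X-⊛-suc g n = begin
  (X ⊛ g) (suc n)
    ≡⟨ ⊛-as-∑ X g (suc n) ⟩
  + 0 + (+ 1 * g n + ∑[ _ < n ] (+ 0))
    ≡⟨ cong (λ s → + 0 + (+ 1 * g n + s)) (sum-replicate-zero n) ⟩
  + 0 + (+ 1 * g n + + 0)
    ≡⟨ unit (g n) ⟩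
  g n
    ∎
  where
  unit : ∀ x → + 0 + (+ 1 * x + + 0) ≡ x
  unit = solve-∀

X⊛-⊛-suc : ∀ f g n → ((X ⊛ f) ⊛ g) (suc n) ≡ (f ⊛ g) n
X⊛-⊛-suc f g n = begin
  ((X ⊛ f) ⊛ g) (suc n)
    ≡⟨ ⊛-as-∑ (X ⊛ f) g (suc n) ⟩
  + 0 + ∑[ i < suc n ] ((X ⊛ f) (suc (toℕ i)) * g (n ∸ toℕ i))
    ≡⟨ ℤₚ.+-identityˡ _ ⟩
  ∑[ i < suc n ] ((X ⊛ f) (suc (toℕ i)) * g (n ∸ toℕ i))
    ≡⟨ sum-cong-≗ {suc n} (λ i → cong (_* g (n ∸ toℕ i)) (X-⊛-suc f (toℕ i))) ⟩
  ∑[ i < suc n ] (f (toℕ i) * g (n ∸ toℕ i))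
    ≡⟨ ⊛-as-∑ f g n ⟨
  (f ⊛ g) n
    ∎

geometric-⊛-suc : ∀ p b n → ((p ^_) ⊛ b) (suc n) ≡ b (suc n) + p * ((p ^_) ⊛ b) n
geometric-⊛-suc p b n = begin
  ((p ^_) ⊛ b) (suc n)
    ≡⟨ ⊛-as-∑ (p ^_) b (suc n) ⟩
  + 1 * b (suc n) + ∑[ i < suc n ] (p * p ^ toℕ i * b (n ∸ toℕ i))
    ≡⟨ cong₂ _+_ (ℤₚ.*-identityˡ (b (suc n))) (sum-cong-≗ {suc n} (λ i → ℤₚ.*-assoc p (p ^ toℕ i) (b (n ∸ toℕ i)))) ⟩
  b (suc n) + ∑[ i < suc n ] (p * (p ^ toℕ i * b (n ∸ toℕ i)))
    ≡⟨ cong (_+_ (b (suc n))) (*-distribˡ-sum {suc n} p (λ i → p ^ toℕ i * b (n ∸ toℕ i))) ⟨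
  b (suc n) + p * ∑[ i < suc n ] (p ^ toℕ i * b (n ∸ toℕ i))
    ≡⟨ cong (λ s → b (suc n) + p * s) (⊛-as-∑ (p ^_) b n) ⟨
  b (suc n) + p * ((p ^_) ⊛ b) n
    ∎

invVec-toList : ∀ f n → Vec.toList (invVec f n) ≡ applyUpTo (λ i → inv1 f (n ∸ i)) (suc n)
invVec-toList f zero    = refl
invVec-toList f (suc n) = cong (inv1 f (suc n) ∷_) (invVec-toList f n)

inv1-suc : ∀ f n → inv1 f (suc n) ≡ - ∑[ i < suc n ] (f (suc (toℕ i)) * inv1 f (n ∸ toℕ i))
inv1-suc f n = cong -_ (begin
  sumℤ (zipWith _*_ (map (λ j → f (suc j)) (upTo (suc n))) (Vec.toList (invVec f n)))
    ≡⟨ cong₂ (λ xs ys → sumℤ (zipWith _*_ xs ys)) (map-applyUpTo (λ i → i) (λ j → f (suc j)) (suc n)) (invVec-toList f n) ⟩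
  sumℤ (zipWith _*_ (applyUpTo (λ j → f (suc j)) (suc n)) (applyUpTo (λ i → inv1 f (n ∸ i)) (suc n)))
    ≡⟨ sumℤ-zipWith-applyUpTo (λ j → f (suc j)) (λ i → inv1 f (n ∸ i)) (suc n) ⟩
  ∑[ i < suc n ] (f (suc (toℕ i)) * inv1 f (n ∸ toℕ i))
    ∎)

module InvOneMinusCX² (c : ℤ) where

  D : Series
  D = oneS ⊖ scale c (X ⊛ X)

  E : Series
  E = inv1 D

  D-suc : ∀ i → D (suc i) ≡ + 0 - c * X i
  D-suc i = cong (λ x → + 0 - c * x) (X-⊛-suc X i)

  E-1 : E 1 ≡ + 0
  E-1 = trans (cong (λ d → - (d * + 1 + + 0)) (D-suc 0)) (vanish c)
    where
    vanish : ∀ c → - ((+ 0 - c * + 0) * + 1 + + 0) ≡ + 0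
    vanish = solve-∀

  E-suc-suc : ∀ n → E (suc (suc n)) ≡ c * E n
  E-suc-suc n = begin
    E (suc (suc n))
      ≡⟨ inv1-suc D (suc n) ⟩
    - (D 1 * E (suc n) + (D 2 * E n + ∑[ i < n ] (D (3 ℕ.+ toℕ i) * E (n ∸ suc (toℕ i)))))
      ≡⟨ cong (λ s → - (D 1 * E (suc n) + (D 2 * E n + s))) tail-vanishes ⟩
    - (D 1 * E (suc n) + (D 2 * E n + + 0))
      ≡⟨ cong₂ (λ d₁ d₂ → - (d₁ * E (suc n) + (d₂ * E n + + 0))) (D-suc 0) (D-suc 1) ⟩
    - ((+ 0 - c * + 0) * E (suc n) + ((+ 0 - c * + 1) * E n + + 0))
      ≡⟨ simplify c (E (suc n)) (E n) ⟩
    c * E n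
      ∎
    where
    annihilate : ∀ c x → (+ 0 - c * + 0) * x ≡ + 0
    annihilate = solve-∀
    simplify : ∀ c x y → - ((+ 0 - c * + 0) * x + ((+ 0 - c * + 1) * y + + 0)) ≡ c * y
    simplify = solve-∀
    tail-vanishes : ∑[ i < n ] (D (3 ℕ.+ toℕ i) * E (n ∸ suc (toℕ i))) ≡ + 0
    tail-vanishes = trans
      (sum-cong-≗ {n} (λ i → trans (cong (_* E (n ∸ suc (toℕ i))) (D-suc (2 ℕ.+ toℕ i))) (annihilate c _)))
      (sum-replicate-zero n)

-- The inner series (x + p x²)/(1 - p² x²) of the right-hand side, which equals x/(1 - p x).
G : ℤ → Series
G p = (X ⊕ scale p (X ⊛ X)) ⊛ InvOneMinusCX².E (p * p)

G-suc : ∀ p n → G p (suc n) ≡ p ^ n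
G-suc p n = begin
  G p (suc n)
    ≡⟨ ⊕-⊛ X (scale p (X ⊛ X)) E (suc n) ⟩
  (X ⊛ E) (suc n) + (scale p (X ⊛ X) ⊛ E) (suc n)
    ≡⟨ cong₂ _+_ (X-⊛-suc E n) (trans (scale-⊛ p (X ⊛ X) E (suc n)) (cong (p *_) (X⊛-⊛-suc X E n))) ⟩
  E n + p * (X ⊛ E) n
    ≡⟨ shifted n ⟩
  p ^ n
    ∎
  where
  open InvOneMinusCX² (p * p)
  geometric : ∀ n → E (suc n) + p * E n ≡ p ^ suc n
  geometric zero    = trans (cong (_+ p * + 1) E-1) (ℤₚ.+-identityˡ (p * + 1))
  geometric (suc n) = begin
    E (suc (suc n)) + p * E (suc n)
      ≡⟨ cong (_+ p * E (suc n)) (E-suc-suc n) ⟩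
    p * p * E n + p * E (suc n)
      ≡⟨ factor p (E n) (E (suc n)) ⟩
    p * (E (suc n) + p * E n)
      ≡⟨ cong (p *_) (geometric n) ⟩
    p ^ suc (suc n)
      ∎
    where
    factor : ∀ p e₀ e₁ → p * p * e₀ + p * e₁ ≡ p * (e₁ + p * e₀)
    factor = solve-∀
  shifted : ∀ n → E n + p * (X ⊛ E) n ≡ p ^ n
  shifted zero    = cong (_+_ (+ 1)) (ℤₚ.*-zeroʳ p)
  shifted (suc n) = trans (cong (λ e → E (suc n) + p * e) (X-⊛-suc E n)) (geometric n)

module _ (k : ℕ) (q : ℤ) where
  private
    p = q - + 1
    K₁ = + k - + 1
    b = RHS k q
    H = (p ^_) ⊛ b
    F = oneS ⊖ X ⊖ scale K₁ (G p)

  RHS-suc : ∀ n → RHS k q (suc n) ≡ K₁ * H n + b n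
  RHS-suc n = begin
    b (suc n)
      ≡⟨ inv1-suc F n ⟩
    - (F 1 * b n + ∑[ i < n ] (F (2 ℕ.+ toℕ i) * b (n ∸ suc (toℕ i))))
      ≡⟨ cong₂ (λ f₁ s → - (f₁ * b n + s)) (cong (λ g → (+ 0 - + 1) - K₁ * g) (G-suc p 0)) tail ⟩
    - (((+ 0 - + 1) - K₁ * + 1) * b n + - K₁ * ∑[ i < n ] (p ^ suc (toℕ i) * b (n ∸ suc (toℕ i))))
      ≡⟨ simplify K₁ (b n) _ ⟩
    K₁ * (+ 1 * b n + ∑[ i < n ] (p ^ suc (toℕ i) * b (n ∸ suc (toℕ i)))) + b n
      ≡⟨ cong (λ h → K₁ * h + b n) (⊛-as-∑ (p ^_) b n) ⟨
    K₁ * H n + b n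
      ∎
    where
    distribute : ∀ K g x → ((+ 0 - + 0) - K * g) * x ≡ - K * (g * x)
    distribute = solve-∀
    simplify : ∀ K x s → - (((+ 0 - + 1) - K * + 1) * x + - K * s) ≡ K * (+ 1 * x + s) + x
    simplify = solve-∀
    tail : ∑[ i < n ] (F (2 ℕ.+ toℕ i) * b (n ∸ suc (toℕ i)))
         ≡ - K₁ * ∑[ i < n ] (p ^ suc (toℕ i) * b (n ∸ suc (toℕ i)))
    tail = begin
      ∑[ i < n ] (F (2 ℕ.+ toℕ i) * b (n ∸ suc (toℕ i)))
        ≡⟨ sum-cong-≗ {n} (λ i → trans (cong (λ g → ((+ 0 - + 0) - K₁ * g) * b (n ∸ suc (toℕ i))) (G-suc p (suc (toℕ i))))
                                        (distribute K₁ _ _)) ⟩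
      ∑[ i < n ] (- K₁ * (p ^ suc (toℕ i) * b (n ∸ suc (toℕ i))))
        ≡⟨ *-distribˡ-sum {n} (- K₁) (λ i → p ^ suc (toℕ i) * b (n ∸ suc (toℕ i))) ⟨
      - K₁ * ∑[ i < n ] (p ^ suc (toℕ i) * b (n ∸ suc (toℕ i)))
        ∎

  RHS-1 : RHS k q 1 ≡ + k
  RHS-1 = trans (RHS-suc 0) (unit (+ k))
    where
    unit : ∀ k → (k - + 1) * + 1 + + 1 ≡ k
    unit = solve-∀

  RHS-rec : ∀ n → RHS k q (suc (suc n)) ≡ (+ k + p) * RHS k q (suc n) - p * RHS k q n
  RHS-rec n = begin
    b (suc (suc n))
      ≡⟨ RHS-suc (suc n) ⟩
    K₁ * H (suc n) + b (suc n)
      ≡⟨ cong (λ h → K₁ * h + b (suc n)) (geometric-⊛-suc p b n) ⟩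
    K₁ * (b (suc n) + p * H n) + b (suc n)
      ≡⟨ regroup (+ k) p (b (suc n)) (H n) ⟩
    (+ k + p) * b (suc n) - p * (b (suc n) - K₁ * H n)
      ≡⟨ cong (λ x → (+ k + p) * b (suc n) - p * x) (trans (cong (_- K₁ * H n) (RHS-suc n)) (cancel (K₁ * H n) (b n))) ⟩
    (+ k + p) * b (suc n) - p * b n
      ∎
    where
    regroup : ∀ k p b₁ h → (k - + 1) * (b₁ + p * h) + b₁ ≡ (k + p) * b₁ - p * (b₁ - (k - + 1) * h)
    regroup = solve-∀
    cancel : ∀ x y → (x + y) - x ≡ y
    cancel = solve-∀

theorem1 : (k : ℕ) → 1 ≤ k → (q : ℤ) → (n : ℕ) → Ck k q n ≡ RHS k q n
theorem1 (suc k') (s≤s z≤n) q =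
  second-order-recurrence-unique (+ suc k' + (q - + 1)) (q - + 1) (Ck (suc k') q) (RHS (suc k') q)
    (Ck-rec k' q) (RHS-rec (suc k') q)
    refl (trans (Words.Ck-1 (suc k') q) (sym (RHS-1 (suc k') q)))
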